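{- Let $G$ be a singleton-partition graph with $\delta(G)=2$ and with no full vertex, and let $B={\rm CG}(G,\Gamma_1)$. Suppose $B$ is a singleton-partition graph and $B\in\mathcal{H}_2^1$. Then the $G$-SC chain is one of the following chains: (a) $G\to B\to\overline{K}_4$; (b) $G\to B\to\overline{K}_3\cup K_2$; (c) $G\to B\to\overline{K}_2\cup K_2$; (d) $G\to B\to\overline{K}_2\cup P_3$.
   Context: All graphs are finite and simple. A full vertex is a vertex adjacent to all other vertices. A set $D\subseteq V$ is dominating if every vertex not in $D$ has a neighbor in $D$. Two disjoint sets $A,B\subseteq V$ form a coalition if neither is dominating but $A\cup B$ is. A coalition partition of $G$ is a partition $\mathcal{P}$ of $V$ such that every member is either a dominating set of cardinality 1, or is not dominating and forms a coalition with some other member. The coalition graph ${\rm CG}(G,\mathcal{P})$ has vertex set $\mathcal{P}$, two members adjacent iff they form a coalition. $\Gamma_1$ is the partition of $V$ into singletons; $G$ is a singleton-partition graph (SP-graph) if $\Gamma_1$ is a coalition partition of $G$. A singleton coalition graph chain with initial graph $G_1$ is a sequence $G_1\to G_2\to\cdots$ where each graph having a successor is an SP-graph and its successor is ${\rm CG}(G_i,\Gamma_1)$ (up to isomorphism). The $G$-SC chain is such a chain starting at $G$ of maximum possible length (it continues as long as the current graph is an SP-graph). $\overline{K}_m$ is the edgeless graph on $m$ vertices, $\cup$ disjoint union. The family $\mathcal{H}_2^1$: graphs with vertex set $\{x',y',z'\}\cup R_1'$ where $R_1'\neq\emptyset$; $\{x',y',z'\}$ induces $K_3$; every vertex of $R_1'$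 is adjacent to both $y'$ and $z'$; $R_1'$ is an independent set; additionally $x'$ may be joined to some (possibly none) vertices of $R_1'$; there are no other edges. -}

module Defs where

open import Data.Nat using (ℕ; zero; suc; _≤_)
open import Data.Fin using (Fin; zero; suc; _≟_)
open import Data.Bool using (Bool; true; false; _∧_; _∨_; not; if_then_else_)
open import Data.Product using (Σ; _×_; _,_; proj₁; proj₂; ∃; ∃-syntax)
open import Data.List using (List; []; _∷_)
open import Data.Bool.ListAction using (any)
open import Data.Fin using (#_)
open import Data.Sum using (_⊎_)
open import Relation.Nullary using (¬_)
open import Relation.Nullary.Decidable using (isYes)
open import Relation.Binary.PropositionalEquality using (_≡_; _≢_)
open import Function.Bundles using (_↔_; Inverse)

record Graph : Set where
  field
    n   : ℕ
    adj : Fin n → Fin n → Bool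
open Graph public

IsSimple : Graph → Set
IsSimple G = (∀ u v → adj G u v ≡ adj G v u) × (∀ v → adj G v v ≡ false)

all-Fin : (n : ℕ) → (Fin n → Bool) → Bool
all-Fin zero    f = true
all-Fin (suc n) f = f zero ∧ all-Fin n (λ i → f (suc i))

any-Fin : (n : ℕ) → (Fin n → Bool) → Bool
any-Fin zero    f = false
any-Fin (suc n) f = f zero ∨ any-Fin n (λ i → f (suc i))

count-Fin : (n : ℕ) → (Fin n → Bool) → ℕ
count-Fin zero    f = zero
count-Fin (suc n) f = (if f zero then 1 else 0) Data.Nat.+ count-Fin n (λ i → f (suc i))
  where import Data.Nat

VSet : Graph → Set
VSet G = Fin (n G) → Bool

_∪_ : {G : Graph} → VSet G → VSet G → VSet G
(A ∪ B) v = A v ∨ B v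

singleton : (G : Graph) → Fin (n G) → VSet G
singleton G v u = isYes (u ≟ v)

dominating : (G : Graph) → VSet G → Bool
dominating G D = all-Fin (n G) (λ v → D v ∨ any-Fin (n G) (λ u → D u ∧ adj G u v))

disjoint : (G : Graph) → VSet G → VSet G → Bool
disjoint G A B = all-Fin (n G) (λ v → not (A v ∧ B v))

coalition : (G : Graph) → VSet G → VSet G → Bool
coalition G A B = disjoint G A B ∧ not (dominating G A) ∧ not (dominating G B)
                  ∧ dominating G (_∪_ {G} A B)

-- G is an SP-graph: Γ₁ (partition into singletons) is a coalition partition,
-- i.e. every singleton {v} is dominating (it has cardinality 1), or is not
-- dominating and forms a coalition with some other singleton {w}.
SP-graph : Graph → Set
SP-graph G = ∀ (v : Fin (n G)) →
    (dominating G (singleton G v) ≡ true)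
  ⊎ ((dominating G (singleton G v) ≡ false)
     × (∃[ w ] (w ≢ v × coalition G (singleton G v) (singleton G w) ≡ true)))

-- coalition graph CG(G, Γ₁): vertex set Γ₁ (identified with Fin n via v ↦ {v}),
-- {u},{v} adjacent iff they form a coalition
CG₁ : Graph → Graph
CG₁ G = record { n = n G ; adj = λ u v → coalition G (singleton G u) (singleton G v) }

_≅_ : Graph → Graph → Set
G ≅ H = Σ (Fin (n G) ↔ Fin (n H)) λ f →
          ∀ u v → adj G u v ≡ adj H (Inverse.to f u) (Inverse.to f v)

degree : (G : Graph) → Fin (n G) → ℕ
degree G v = count-Fin (n G) (λ u → adj G v u)

MinDegree : Graph → ℕ → Set
MinDegree G d = (∃[ v ] degree G v ≡ d) × (∀ v → d ≤ degree G v)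

IsFull : (G : Graph) → Fin (n G) → Set
IsFull G v = ∀ u → u ≢ v → adj G v u ≡ true

-- membership in the family H_2^1 (up to relabelling of vertices):
-- distinct x', y', z' forming a triangle; R' = the remaining vertices, nonempty,
-- independent, each adjacent to y' and z'; x' may be adjacent to any vertices of R';
-- no other edges.
InR : (B : Graph) → (x y z r : Fin (n B)) → Set
InR B x y z r = r ≢ x × r ≢ y × r ≢ z

InH21 : Graph → Set
InH21 B = ∃[ x ] ∃[ y ] ∃[ z ]
    (x ≢ y × x ≢ z × y ≢ z
   × adj B x y ≡ true × adj B x z ≡ true × adj B y z ≡ true
   × (∃[ r ] InR B x y z r)
   × (∀ r → InR B x y z r → adj B r y ≡ true × adj B r z ≡ true)
   × (∀ r s → InR B x y z r → InR B x y z s → adj B r s ≡ false))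

fromEdges : (m : ℕ) → List (Fin m × Fin m) → Graph
fromEdges m es = record { n = m ; adj = λ u v →
  any (λ e → (isYes (proj₁ e ≟ u) ∧ isYes (proj₂ e ≟ v))
           ∨ (isYes (proj₁ e ≟ v) ∧ isYes (proj₂ e ≟ u))) es }

K̄4 : Graph
K̄4 = fromEdges 4 []

K̄3∪K2 : Graph
K̄3∪K2 = fromEdges 5 ((# 3 , # 4) ∷ [])

K̄2∪K2 : Graph
K̄2∪K2 = fromEdges 4 ((# 2 , # 3) ∷ [])

K̄2∪P3 : Graph
K̄2∪P3 = fromEdges 5 ((# 2 , # 3) ∷ (# 3 , # 4) ∷ [])

-- In B = CG(G, Γ₁) ∈ H₂¹ the vertices y′ and z′ are full, so {y′} and {z′} dominate and are
-- isolated in CG(B, Γ₁); two isolated vertices and a third one already rule out the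
-- SP property of CG(B, Γ₁). Since B is an SP-graph, a vertex r ∈ R′ either dominates alone
-- (then R′ = {r} and B ≅ K₄), or forms a coalition with x′ or with a second vertex of R′.
-- As R′ is independent, two vertices of R′ dominate together only if they are all of R′;
-- if r partners x′, then x′ ≁ r (else x′ would be full) and any further s ∈ R′ can only
-- partner r. Hence |R′| ≤ 2 and B is one of four explicit graphs, whose coalition graphs
-- are computed by evaluation and transported along the isomorphism.

module Submission where

open import Defs
open import Data.Nat using (zero; suc; _+_)
open import Data.Fin using (Fin; zero; suc; _≟_)
open import Data.Fin.Properties using (any?)
open import Data.Bool using (Bool; true; false; _∧_; _∨_; not)
import Data.Bool as Bool
open import Data.Bool.Properties using (∧-comm; ∨-comm; ∧-zeroʳ; ∧-commutativeMonoid; ∧-conicalˡ; ∧-conicalʳ; not-injective; not-¬; ¬-not)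
open import Algebra.Bundles using (CommutativeMonoid)
open import Algebra.Properties.CommutativeSemigroup (CommutativeMonoid.commutativeSemigroup ∧-commutativeMonoid)
  using (x∙yz≈y∙xz)
open import Data.Vec using (Vec; []; _∷_; lookup)
open import Data.Product using (_×_; _,_; proj₁; proj₂; ∃-syntax)
open import Data.Sum using (_⊎_; inj₁; inj₂; [_,_])
import Data.Sum as Sum
open import Data.Empty using (⊥-elim)
open import Function using (_∘_)
open import Function.Bundles using (Inverse; mk⤖)
open import Function.Definitions using (Injective; StrictlySurjective)
open import Function.Consequences.Propositional using (strictlySurjective⇒surjective)
open import Function.Properties.Bijection using (⤖⇒↔)
open import Function.Properties.Inverse using (↔-refl; ↔-sym; ↔-trans)
open import Relation.Nullary using (¬_; yes; no; ¬?; Dec)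
open import Relation.Nullary.Decidable using (isYes; _×-dec_)
open import Relation.Binary.PropositionalEquality hiding ([_])

∨-true⁻ : ∀ a b → a ∨ b ≡ true → a ≡ true ⊎ b ≡ true
∨-true⁻ true  _ _ = inj₁ refl
∨-true⁻ false _ e = inj₂ e

≡-from-true⇔true : ∀ {a b} → (a ≡ true → b ≡ true) → (b ≡ true → a ≡ true) → a ≡ b
≡-from-true⇔true {false} {false} _ _ = refl
≡-from-true⇔true {false} {true}  _ g = g refl
≡-from-true⇔true {true}  {false} f _ = sym (f refl)
≡-from-true⇔true {true}  {true}  _ _ = refl

all-Fin-sound : ∀ m (f : Fin m → Bool) → all-Fin m f ≡ true → ∀ i → f i ≡ true
all-Fin-sound (suc m) f e zero    = ∧-conicalˡ _ _ e
all-Fin-sound (suc m) f e (suc i) = all-Fin-sound m (f ∘ suc) (∧-conicalʳ _ _ e) i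

all-Fin-complete : ∀ m (f : Fin m → Bool) → (∀ i → f i ≡ true) → all-Fin m f ≡ true
all-Fin-complete zero    f h = refl
all-Fin-complete (suc m) f h rewrite h zero = all-Fin-complete m (f ∘ suc) (h ∘ suc)

all-Fin-false : ∀ m (f : Fin m → Bool) i → f i ≡ false → all-Fin m f ≡ false
all-Fin-false (suc m) f zero    e rewrite e = refl
all-Fin-false (suc m) f (suc i) e = trans (cong (f zero ∧_) (all-Fin-false m (f ∘ suc) i e)) (∧-zeroʳ (f zero))

any-Fin-sound : ∀ m (f : Fin m → Bool) → any-Fin m f ≡ true → ∃[ i ] f i ≡ true
any-Fin-sound (suc m) f e with f zero in eq
... | true  = zero , eq
... | false with any-Fin-sound m (f ∘ suc) e
...   | i , p = suc i , p

any-Fin-complete : ∀ m (f : Fin m → Bool) i → f i ≡ true → any-Fin m f ≡ true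
any-Fin-complete (suc m) f zero    p rewrite p = refl
any-Fin-complete (suc m) f (suc i) p with f zero
... | true  = refl
... | false = any-Fin-complete m (f ∘ suc) i p

all-Fin-cong : ∀ m {f g : Fin m → Bool} → f ≗ g → all-Fin m f ≡ all-Fin m g
all-Fin-cong zero    h = refl
all-Fin-cong (suc m) h = cong₂ _∧_ (h zero) (all-Fin-cong m (h ∘ suc))

any-Fin-cong : ∀ m {f g : Fin m → Bool} → f ≗ g → any-Fin m f ≡ any-Fin m g
any-Fin-cong zero    h = refl
any-Fin-cong (suc m) h = cong₂ _∨_ (h zero) (any-Fin-cong m (h ∘ suc))

-- Graph isomorphism and invariance of CG₁

≅-by-evaluation : ∀ G (b : Fin (n G) → Fin (n G) → Bool)
  → all-Fin (n G) (λ i → all-Fin (n G) (λ j → isYes (adj G i j Bool.≟ b i j))) ≡ true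
  → G ≅ record { n = n G ; adj = b }
≅-by-evaluation G b e = ↔-refl , agree
  where
  agree : ∀ i j → adj G i j ≡ b i j
  agree i j with adj G i j Bool.≟ b i j | all-Fin-sound _ _ (all-Fin-sound _ _ e i) j
  ... | yes p | _ = p
  ... | no  _ | ()

≅-sym : ∀ {G H} → G ≅ H → H ≅ G
≅-sym {G} {H} (f , h) = ↔-sym f , λ u v → begin
    adj H u v                          ≡⟨ sym (cong₂ (adj H) (strictlyInverseˡ u) (strictlyInverseˡ v)) ⟩
    adj H (to (from u)) (to (from v))  ≡⟨ sym (h (from u) (from v)) ⟩
    adj G (from u) (from v)            ∎
  where open Inverse f; open ≡-Reasoning

≅-trans : ∀ {G H K} → G ≅ H → H ≅ K → G ≅ K
≅-trans (f , h) (g , k) = ↔-trans f g , λ u v → trans (h u v) (k _ _)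

module _ {G H : Graph} (iso : G ≅ H) where
  open Inverse (proj₁ iso)

  to-injective : Injective _≡_ _≡_ to
  to-injective {u} {v} e = begin
    u              ≡⟨ sym (strictlyInverseʳ u) ⟩
    from (to u)    ≡⟨ cong from e ⟩
    from (to v)    ≡⟨ strictlyInverseʳ v ⟩
    v              ∎
    where open ≡-Reasoning

  all-Fin-transport : (f : Fin (n H) → Bool) → all-Fin (n G) (f ∘ to) ≡ all-Fin (n H) f
  all-Fin-transport f = ≡-from-true⇔true
    (λ e → all-Fin-complete _ f λ v →
      subst (λ w → f w ≡ true) (strictlyInverseˡ v) (all-Fin-sound _ _ e (from v)))
    (λ e → all-Fin-complete _ _ (all-Fin-sound _ f e ∘ to))

  any-Fin-transport : (f : Fin (n H) → Bool) → any-Fin (n G) (f ∘ to) ≡ any-Fin (n H) f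
  any-Fin-transport f = ≡-from-true⇔true
    (λ e → let (i , p) = any-Fin-sound _ _ e in any-Fin-complete _ f (to i) p)
    (λ e → let (v , p) = any-Fin-sound _ f e in
      any-Fin-complete _ _ (from v) (subst (λ w → f w ≡ true) (sym (strictlyInverseˡ v)) p))

  dominating-transport : (A′ : VSet G) (A : VSet H) → A′ ≗ A ∘ to → dominating G A′ ≡ dominating H A
  dominating-transport A′ A eq = trans
    (all-Fin-cong _ λ i → cong₂ _∨_ (eq i)
      (trans (any-Fin-cong _ λ k → cong₂ _∧_ (eq k) (proj₂ iso k i))
             (any-Fin-transport (λ u → A u ∧ adj H u (to i)))))
    (all-Fin-transport (λ v → A v ∨ any-Fin (n H) (λ u → A u ∧ adj H u v)))

  disjoint-transport : (A′ C′ : VSet G) (A C : VSet H) → A′ ≗ A ∘ to → C′ ≗ C ∘ to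
    → disjoint G A′ C′ ≡ disjoint H A C
  disjoint-transport A′ C′ A C eqA eqC = trans
    (all-Fin-cong _ λ i → cong not (cong₂ _∧_ (eqA i) (eqC i)))
    (all-Fin-transport (λ v → not (A v ∧ C v)))

  coalition-transport : (A′ C′ : VSet G) (A C : VSet H) → A′ ≗ A ∘ to → C′ ≗ C ∘ to
    → coalition G A′ C′ ≡ coalition H A C
  coalition-transport A′ C′ A C eqA eqC =
    cong₂ _∧_ (disjoint-transport A′ C′ A C eqA eqC)
      (cong₂ _∧_ (cong not (dominating-transport A′ A eqA))
        (cong₂ _∧_ (cong not (dominating-transport C′ C eqC))
          (dominating-transport (_∪_ {G} A′ C′) (_∪_ {H} A C) λ i → cong₂ _∨_ (eqA i) (eqC i))))

  singleton-transport : ∀ v → singleton G v ≗ singleton H (to v) ∘ to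
  singleton-transport v i with i ≟ v | to i ≟ to v
  ... | yes _   | yes _   = refl
  ... | no  _   | no  _   = refl
  ... | yes i≡v | no  i≢v = ⊥-elim (i≢v (cong to i≡v))
  ... | no  i≢v | yes e   = ⊥-elim (i≢v (to-injective e))

  CG₁-cong : CG₁ G ≅ CG₁ H
  CG₁-cong = proj₁ iso , λ u v →
    coalition-transport _ _ _ _ (singleton-transport u) (singleton-transport v)

-- Domination by singletons and pairs

pair : (G : Graph) → Fin (n G) → Fin (n G) → VSet G
pair G v w = _∪_ {G} (singleton G v) (singleton G w)

module _ {G : Graph} where

  singleton-self : ∀ v → singleton G v v ≡ true
  singleton-self v with v ≟ v
  ... | yes _   = refl
  ... | no  v≢v = ⊥-elim (v≢v refl)

  singleton⁻ : ∀ {v u} → singleton G v u ≡ true → u ≡ v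
  singleton⁻ {v} {u} e with u ≟ v
  ... | yes u≡v = u≡v

  pair⁻ : ∀ {v w u} → pair G v w u ≡ true → u ≡ v ⊎ u ≡ w
  pair⁻ e = Sum.map singleton⁻ singleton⁻ (∨-true⁻ _ _ e)

  dominating⇒neighbour : ∀ {A} → dominating G A ≡ true → ∀ {u} → A u ≢ true
    → ∃[ k ] A k ≡ true × adj G k u ≡ true
  dominating⇒neighbour {A} d {u} u∉A with ∨-true⁻ _ _ (all-Fin-sound _ _ d u)
  ... | inj₁ u∈A = ⊥-elim (u∉A u∈A)
  ... | inj₂ e with any-Fin-sound _ _ e
  ...   | k , k∈A∧adj = k , ∧-conicalˡ _ _ k∈A∧adj , ∧-conicalʳ _ _ k∈A∧adj

  dominating⇒full : ∀ {v} → dominating G (singleton G v) ≡ true → IsFull G v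
  dominating⇒full {v} d u u≢v with dominating⇒neighbour d (u≢v ∘ singleton⁻)
  ... | k , k∈A , adj-ku rewrite singleton⁻ k∈A = adj-ku

  full⇒dominating : ∀ {v} → IsFull G v → dominating G (singleton G v) ≡ true
  full⇒dominating {v} full = all-Fin-complete _ _ covered
    where
    covered : ∀ u → (singleton G v u ∨ any-Fin (n G) (λ k → singleton G v k ∧ adj G k u)) ≡ true
    covered u with u ≟ v
    ... | yes _   = refl
    ... | no  u≢v = any-Fin-complete _ _ v
                      (subst (λ b → (b ∧ adj G v u) ≡ true) (sym (singleton-self v)) (full u u≢v))

  pair-dominating⇒adj : ∀ {v w} → dominating G (pair G v w) ≡ true
    → ∀ u → u ≢ v → u ≢ w → adj G v u ≡ true ⊎ adj G w u ≡ true
  pair-dominating⇒adj {v} {w} d u u≢v u≢w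
    with dominating⇒neighbour d ([ u≢v , u≢w ] ∘ pair⁻)
  ... | k , k∈A , adj-ku with pair⁻ {v} {w} {k} k∈A
  ...   | inj₁ refl = inj₁ adj-ku
  ...   | inj₂ refl = inj₂ adj-ku

  uncovered⇒¬pair-dominating : ∀ {v w u} → u ≢ v → u ≢ w → adj G v u ≡ false → adj G w u ≡ false
    → dominating G (pair G v w) ≢ true
  uncovered⇒¬pair-dominating {u = u} u≢v u≢w v≁u w≁u d =
    [ (λ v~u → not-¬ v~u v≁u) , (λ w~u → not-¬ w~u w≁u) ] (pair-dominating⇒adj d u u≢v u≢w)

  pair-dominating⇒adj₂ : ∀ {v w u} → dominating G (pair G v w) ≡ true → u ≢ v → u ≢ w
    → adj G v u ≡ false → adj G w u ≡ true
  pair-dominating⇒adj₂ {u = u} d u≢v u≢w v≁u with pair-dominating⇒adj d u u≢v u≢w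
  ... | inj₁ v~u = ⊥-elim (not-¬ v~u v≁u)
  ... | inj₂ w~u = w~u

  coalition⁻ : ∀ {A C} → coalition G A C ≡ true
    → dominating G A ≡ false × dominating G C ≡ false × dominating G (_∪_ {G} A C) ≡ true
  coalition⁻ {A} {C} c =
      not-injective {y = false} (∧-conicalˡ _ _ c′)
    , not-injective {y = false} (∧-conicalˡ _ _ c″)
    , ∧-conicalʳ _ _ c″
    where
    c′ = ∧-conicalʳ (disjoint G A C) _ c
    c″ = ∧-conicalʳ (not (dominating G A)) _ c′

  dominating-cong : ∀ {A C} → A ≗ C → dominating G A ≡ dominating G C
  dominating-cong A≗C = all-Fin-cong _ λ u →
    cong₂ _∨_ (A≗C u) (any-Fin-cong _ λ k → cong (_∧ adj G k u) (A≗C k))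

  coalition-sym : ∀ A C → coalition G A C ≡ coalition G C A
  coalition-sym A C = cong₂ _∧_
    (all-Fin-cong _ λ u → cong not (∧-comm (A u) (C u)))
    (trans (cong (λ d → not (dominating G A) ∧ (not (dominating G C) ∧ d))
                 (dominating-cong λ u → ∨-comm (A u) (C u)))
           (x∙yz≈y∙xz (not (dominating G A)) (not (dominating G C)) (dominating G (_∪_ {G} C A))))

CG₁-simple : ∀ G → IsSimple (CG₁ G)
CG₁-simple G = (λ u v → coalition-sym (singleton G u) (singleton G v)) , loopless
  where
  loopless : ∀ v → adj (CG₁ G) v v ≡ false
  loopless v rewrite all-Fin-false (n G) (λ w → not (singleton G v w ∧ singleton G v w)) v
                       (cong (λ b → not (b ∧ b)) (singleton-self {G} v)) = refl

Isolated : (G : Graph) → Fin (n G) → Set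
Isolated G v = ∀ u → adj G v u ≡ false × adj G u v ≡ false

dominating⇒isolated-in-CG₁ : ∀ {G v} → dominating G (singleton G v) ≡ true → Isolated (CG₁ G) v
dominating⇒isolated-in-CG₁ {G} d u =
    ¬-not (not-¬ d ∘ proj₁ ∘ coalition⁻ {G})
  , ¬-not (not-¬ d ∘ proj₁ ∘ proj₂ ∘ coalition⁻ {G})

two-isolated⇒¬SP-graph : ∀ {G v v′ w} → v′ ≢ v → w ≢ v → w ≢ v′
  → Isolated G v → Isolated G v′ → ¬ SP-graph G
two-isolated⇒¬SP-graph {G} {v} {v′} {w} v′≢v w≢v w≢v′ iso-v iso-v′ sp with sp v
... | inj₁ d = not-¬ (dominating⇒full d v′ v′≢v) (proj₁ (iso-v v′))
... | inj₂ (_ , t , _ , c) with proj₂ (proj₂ (coalition⁻ {G} c)) | t ≟ v′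
...   | d | no t≢v′  = uncovered⇒¬pair-dominating v′≢v (t≢v′ ∘ sym) (proj₁ (iso-v v′)) (proj₂ (iso-v′ t)) d
...   | d | yes refl = uncovered⇒¬pair-dominating w≢v w≢v′ (proj₁ (iso-v w)) (proj₁ (iso-v′ w)) d

-- The family H₂¹

-- The member of H₂¹ with vertices y′, z′, x′, r₀, …, r_{k-1} (in this order) and x′ ~ rᵢ iff lookup N i.
H₂¹-model : ∀ {k} → Vec Bool k → Graph
H₂¹-model {k} N = record { n = 3 + k ; adj = edge }
  where
  edge : Fin (3 + k) → Fin (3 + k) → Bool
  edge zero                zero                = false
  edge (suc zero)          (suc zero)          = false
  edge (suc (suc zero))    (suc (suc zero))    = false
  edge (suc (suc zero))    (suc (suc (suc j))) = lookup N j
  edge (suc (suc (suc i))) (suc (suc zero))    = lookup N i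
  edge (suc (suc (suc i))) (suc (suc (suc j))) = false
  edge _                   _                   = true

module H₂¹-structure (B : Graph) (simple : IsSimple B) (sp : SP-graph B)
  {x y z : Fin (n B)} (x≢y : x ≢ y) (x≢z : x ≢ z) (y≢z : y ≢ z)
  (x~y : adj B x y ≡ true) (x~z : adj B x z ≡ true) (y~z : adj B y z ≡ true)
  (R~yz : ∀ r → InR B x y z r → adj B r y ≡ true × adj B r z ≡ true)
  (R-independent : ∀ r s → InR B x y z r → InR B x y z s → adj B r s ≡ false) where

  adj-sym : ∀ u v → adj B u v ≡ adj B v u
  adj-sym = proj₁ simple

  _∈R : Fin (n B) → Set
  v ∈R = InR B x y z v

  _∈R? : ∀ v → Dec (v ∈R)
  v ∈R? = ¬? (v ≟ x) ×-dec ¬? (v ≟ y) ×-dec ¬? (v ≟ z)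

  vertex-cases : ∀ v → v ≡ x ⊎ v ≡ y ⊎ v ≡ z ⊎ v ∈R
  vertex-cases v with v ≟ x | v ≟ y | v ≟ z
  ... | yes v≡x | _       | _       = inj₁ v≡x
  ... | no  _   | yes v≡y | _       = inj₂ (inj₁ v≡y)
  ... | no  _   | no  _   | yes v≡z = inj₂ (inj₂ (inj₁ v≡z))
  ... | no v≢x  | no v≢y  | no v≢z  = inj₂ (inj₂ (inj₂ (v≢x , v≢y , v≢z)))

  y-full : IsFull B y
  y-full u u≢y with vertex-cases u
  ... | inj₁ refl                = trans (adj-sym y x) x~y
  ... | inj₂ (inj₁ u≡y)          = ⊥-elim (u≢y u≡y)
  ... | inj₂ (inj₂ (inj₁ refl))  = y~z
  ... | inj₂ (inj₂ (inj₂ u∈R))   = trans (adj-sym y u) (proj₁ (R~yz u u∈R))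

  z-full : IsFull B z
  z-full u u≢z with vertex-cases u
  ... | inj₁ refl                = trans (adj-sym z x) x~z
  ... | inj₂ (inj₁ refl)         = trans (adj-sym z y) y~z
  ... | inj₂ (inj₂ (inj₁ u≡z))   = ⊥-elim (u≢z u≡z)
  ... | inj₂ (inj₂ (inj₂ u∈R))   = trans (adj-sym z u) (proj₂ (R~yz u u∈R))

  y-dominating : dominating B (singleton B y) ≡ true
  y-dominating = full⇒dominating y-full

  z-dominating : dominating B (singleton B z) ≡ true
  z-dominating = full⇒dominating z-full

  H₂¹-model≅ : ∀ {k} (N : Vec Bool k) (r : Fin k → Fin (n B))
    → Injective _≡_ _≡_ r → (∀ i → r i ∈R) → (∀ v → v ∈R → ∃[ i ] r i ≡ v)
    → (∀ i → adj B x (r i) ≡ lookup N i)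
    → H₂¹-model N ≅ B
  H₂¹-model≅ {k} N r r-injective r∈R R⊆r x~r =
    ⤖⇒↔ (mk⤖ (vertex-injective , strictlySurjective⇒surjective vertex-surjective)) , vertex-adj
    where
    vertex : Fin (3 + k) → Fin (n B)
    vertex zero                = y
    vertex (suc zero)          = z
    vertex (suc (suc zero))    = x
    vertex (suc (suc (suc i))) = r i

    r≢x : ∀ i → r i ≢ x
    r≢x i = proj₁ (r∈R i)
    r≢y : ∀ i → r i ≢ y
    r≢y i = proj₁ (proj₂ (r∈R i))
    r≢z : ∀ i → r i ≢ z
    r≢z i = proj₂ (proj₂ (r∈R i))

    vertex-injective : Injective _≡_ _≡_ vertex
    vertex-injective {zero}                {zero}                _ = refl
    vertex-injective {zero}                {suc zero}            e = ⊥-elim (y≢z e)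
    vertex-injective {zero}                {suc (suc zero)}      e = ⊥-elim (x≢y (sym e))
    vertex-injective {zero}                {suc (suc (suc j))}   e = ⊥-elim (r≢y j (sym e))
    vertex-injective {suc zero}            {zero}                e = ⊥-elim (y≢z (sym e))
    vertex-injective {suc zero}            {suc zero}            _ = refl
    vertex-injective {suc zero}            {suc (suc zero)}      e = ⊥-elim (x≢z (sym e))
    vertex-injective {suc zero}            {suc (suc (suc j))}   e = ⊥-elim (r≢z j (sym e))
    vertex-injective {suc (suc zero)}      {zero}                e = ⊥-elim (x≢y e)
    vertex-injective {suc (suc zero)}      {suc zero}            e = ⊥-elim (x≢z e)
    vertex-injective {suc (suc zero)}      {suc (suc zero)}      _ = refl
    vertex-injective {suc (suc zero)}      {suc (suc (suc j))}   e = ⊥-elim (r≢x j (sym e))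
    vertex-injective {suc (suc (suc i))}   {zero}                e = ⊥-elim (r≢y i e)
    vertex-injective {suc (suc (suc i))}   {suc zero}            e = ⊥-elim (r≢z i e)
    vertex-injective {suc (suc (suc i))}   {suc (suc zero)}      e = ⊥-elim (r≢x i e)
    vertex-injective {suc (suc (suc i))}   {suc (suc (suc j))}   e = cong (λ l → suc (suc (suc l))) (r-injective e)

    vertex-surjective : StrictlySurjective _≡_ vertex
    vertex-surjective v with vertex-cases v
    ... | inj₁ refl               = suc (suc zero) , refl
    ... | inj₂ (inj₁ refl)        = zero , refl
    ... | inj₂ (inj₂ (inj₁ refl)) = suc zero , refl
    ... | inj₂ (inj₂ (inj₂ v∈R))  = let (i , rᵢ≡v) = R⊆r v v∈R in suc (suc (suc i)) , rᵢ≡v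

    vertex-adj : ∀ i j → adj (H₂¹-model N) i j ≡ adj B (vertex i) (vertex j)
    vertex-adj zero                zero                = sym (proj₂ simple y)
    vertex-adj zero                (suc zero)          = sym y~z
    vertex-adj zero                (suc (suc zero))    = sym (trans (adj-sym y x) x~y)
    vertex-adj zero                (suc (suc (suc j))) = sym (trans (adj-sym y (r j)) (proj₁ (R~yz (r j) (r∈R j))))
    vertex-adj (suc zero)          zero                = sym (trans (adj-sym z y) y~z)
    vertex-adj (suc zero)          (suc zero)          = sym (proj₂ simple z)
    vertex-adj (suc zero)          (suc (suc zero))    = sym (trans (adj-sym z x) x~z)
    vertex-adj (suc zero)          (suc (suc (suc j))) = sym (trans (adj-sym z (r j)) (proj₂ (R~yz (r j) (r∈R j))))
    vertex-adj (suc (suc zero))    zero                = sym x~y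
    vertex-adj (suc (suc zero))    (suc zero)          = sym x~z
    vertex-adj (suc (suc zero))    (suc (suc zero))    = sym (proj₂ simple x)
    vertex-adj (suc (suc zero))    (suc (suc (suc j))) = sym (x~r j)
    vertex-adj (suc (suc (suc i))) zero                = sym (proj₁ (R~yz (r i) (r∈R i)))
    vertex-adj (suc (suc (suc i))) (suc zero)          = sym (proj₂ (R~yz (r i) (r∈R i)))
    vertex-adj (suc (suc (suc i))) (suc (suc zero))    = sym (trans (adj-sym (r i) x) (x~r i))
    vertex-adj (suc (suc (suc i))) (suc (suc (suc j))) = sym (R-independent (r i) (r j) (r∈R i) (r∈R j))

  one-R-vertex : ∀ {r b} → r ∈R → (∀ v → v ∈R → v ≡ r) → adj B x r ≡ b → H₂¹-model (b ∷ []) ≅ B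
  one-R-vertex {r} {b} r∈R R⊆r x~r =
    H₂¹-model≅ (b ∷ []) (λ _ → r) injective (λ _ → r∈R) (λ v v∈R → zero , sym (R⊆r v v∈R)) λ { zero → x~r }
    where
    injective : Injective _≡_ _≡_ (λ (_ : Fin 1) → r)
    injective {zero} {zero} _ = refl

  two-R-vertices : ∀ {r s b c} → r ∈R → s ∈R → r ≢ s → (∀ v → v ∈R → v ≡ r ⊎ v ≡ s)
    → adj B x r ≡ b → adj B x s ≡ c → H₂¹-model (b ∷ c ∷ []) ≅ B
  two-R-vertices {r} {s} {b} {c} r∈R s∈R r≢s R⊆rs x~r x~s =
    H₂¹-model≅ (b ∷ c ∷ []) (lookup (r ∷ s ∷ [])) injective
      (λ { zero → r∈R ; (suc zero) → s∈R })
      (λ v v∈R → [ (λ v≡r → zero , sym v≡r) , (λ v≡s → suc zero , sym v≡s) ] (R⊆rs v v∈R))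
      (λ { zero → x~r ; (suc zero) → x~s })
    where
    injective : Injective _≡_ _≡_ (lookup (r ∷ s ∷ []))
    injective {zero}     {zero}     _ = refl
    injective {zero}     {suc zero} e = ⊥-elim (r≢s e)
    injective {suc zero} {zero}     e = ⊥-elim (r≢s (sym e))
    injective {suc zero} {suc zero} _ = refl

  R⊆pair : ∀ {r s} → r ∈R → s ∈R → dominating B (pair B r s) ≡ true → ∀ v → v ∈R → v ≡ r ⊎ v ≡ s
  R⊆pair {r} {s} r∈R s∈R d v v∈R with v ≟ r | v ≟ s
  ... | yes v≡r | _       = inj₁ v≡r
  ... | no  _   | yes v≡s = inj₂ v≡s
  ... | no v≢r  | no v≢s  = ⊥-elim (uncovered⇒¬pair-dominating v≢r v≢s
                              (R-independent r v r∈R v∈R) (R-independent s v s∈R v∈R) d)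

  Classified : Set
  Classified = H₂¹-model (true ∷ []) ≅ B ⊎ H₂¹-model (true ∷ true ∷ []) ≅ B
             ⊎ H₂¹-model (false ∷ []) ≅ B ⊎ H₂¹-model (false ∷ true ∷ []) ≅ B

  R-partner : ∀ {r t} → r ∈R → t ∈R → t ≢ r → dominating B (pair B r t) ≡ true → Classified
  R-partner {r} {t} r∈R t∈R t≢r d with adj B x r in x~r | adj B x t in x~t
  ... | true  | true  = inj₂ (inj₁ (two-R-vertices r∈R t∈R (t≢r ∘ sym) (R⊆pair r∈R t∈R d) x~r x~t))
  ... | false | true  = inj₂ (inj₂ (inj₂ (two-R-vertices r∈R t∈R (t≢r ∘ sym) (R⊆pair r∈R t∈R d) x~r x~t)))
  ... | true  | false = inj₂ (inj₂ (inj₂ (two-R-vertices t∈R r∈R t≢r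
                          (λ v v∈R → Sum.swap (R⊆pair r∈R t∈R d v v∈R)) x~t x~r)))
  ... | false | false = ⊥-elim (uncovered⇒¬pair-dominating (proj₁ r∈R ∘ sym) (proj₁ t∈R ∘ sym)
                          (trans (adj-sym r x) x~r) (trans (adj-sym t x) x~t) d)

  module _ {r} (r∈R : r ∈R) (x-not-dominating : dominating B (singleton B x) ≡ false)
           (d : dominating B (pair B r x) ≡ true) where

    x~R : ∀ s → s ∈R → s ≢ r → adj B x s ≡ true
    x~R s s∈R s≢r = pair-dominating⇒adj₂ d s≢r (proj₁ s∈R) (R-independent r s r∈R s∈R)

    x-full-if-x~r : adj B x r ≡ true → IsFull B x
    x-full-if-x~r x~r u u≢x with vertex-cases u
    ... | inj₁ u≡x                = ⊥-elim (u≢x u≡x)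
    ... | inj₂ (inj₁ refl)        = x~y
    ... | inj₂ (inj₂ (inj₁ refl)) = x~z
    ... | inj₂ (inj₂ (inj₂ u∈R)) with u ≟ r
    ...   | yes refl = x~r
    ...   | no  u≢r  = x~R u u∈R u≢r

    x≁r : adj B x r ≡ false
    x≁r = ¬-not λ x~r → not-¬ (full⇒dominating (x-full-if-x~r x~r)) x-not-dominating

    x-partner : Classified
    x-partner with any? (λ s → s ∈R? ×-dec ¬? (s ≟ r))
    ... | no ∄s = inj₂ (inj₂ (inj₁ (one-R-vertex r∈R R⊆r x≁r)))
      where
      R⊆r : ∀ v → v ∈R → v ≡ r
      R⊆r v v∈R with v ≟ r
      ... | yes v≡r = v≡r
      ... | no  v≢r = ⊥-elim (∄s (v , v∈R , v≢r))
    -- A second vertex s of R′ is not full (s ≁ r), and its coalition partner must cover r,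
    -- which leaves only r itself; so R′ = {r, s}.
    ... | yes (s , s∈R , s≢r) with sp s
    ...   | inj₁ s-dominating =
      ⊥-elim (not-¬ (dominating⇒full s-dominating r (s≢r ∘ sym)) (R-independent s r s∈R r∈R))
    ...   | inj₂ (_ , t , _ , c) with coalition⁻ {B} c | vertex-cases t
    ...     | _ , _ , d′ | inj₁ refl =
      ⊥-elim (uncovered⇒¬pair-dominating (s≢r ∘ sym) (proj₁ r∈R) (R-independent s r s∈R r∈R) x≁r d′)
    ...     | _ , t-not-dominating , _ | inj₂ (inj₁ refl) = ⊥-elim (not-¬ y-dominating t-not-dominating)
    ...     | _ , t-not-dominating , _ | inj₂ (inj₂ (inj₁ refl)) = ⊥-elim (not-¬ z-dominating t-not-dominating)
    ...     | _ , _ , d′ | inj₂ (inj₂ (inj₂ t∈R)) with R⊆pair s∈R t∈R d′ r r∈R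
    ...       | inj₁ r≡s = ⊥-elim (s≢r (sym r≡s))
    ...       | inj₂ refl = inj₂ (inj₂ (inj₂ (two-R-vertices r∈R s∈R (s≢r ∘ sym)
                  (λ v v∈R → Sum.swap (R⊆pair s∈R t∈R d′ v v∈R)) x≁r (x~R s s∈R s≢r))))

  classification : ∀ {r} → r ∈R → Classified
  classification {r} r∈R with sp r
  ... | inj₁ r-dominating = inj₁ (one-R-vertex r∈R R⊆r (trans (adj-sym x r) (r-full x (proj₁ r∈R ∘ sym))))
    where
    r-full = dominating⇒full r-dominating
    R⊆r : ∀ v → v ∈R → v ≡ r
    R⊆r v v∈R with v ≟ r
    ... | yes v≡r = v≡r
    ... | no  v≢r = ⊥-elim (not-¬ (r-full v v≢r) (R-independent r v r∈R v∈R))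
  ... | inj₂ (_ , w , w≢r , c) with coalition⁻ {B} c | vertex-cases w
  ...   | _ , w-not-dominating , d | inj₁ refl = x-partner r∈R w-not-dominating d
  ...   | _ , w-not-dominating , _ | inj₂ (inj₁ refl) = ⊥-elim (not-¬ y-dominating w-not-dominating)
  ...   | _ , w-not-dominating , _ | inj₂ (inj₂ (inj₁ refl)) = ⊥-elim (not-¬ z-dominating w-not-dominating)
  ...   | _ , _ , d | inj₂ (inj₂ (inj₂ w∈R)) = R-partner r∈R w∈R w≢r d

CG₁-K₄ : CG₁ (H₂¹-model (true ∷ [])) ≅ K̄4
CG₁-K₄ = ≅-by-evaluation _ (adj K̄4) refl

CG₁-K₅-minus-edge : CG₁ (H₂¹-model (true ∷ true ∷ [])) ≅ K̄3∪K2
CG₁-K₅-minus-edge = ≅-by-evaluation _ (adj K̄3∪K2) refl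

CG₁-K₄-minus-edge : CG₁ (H₂¹-model (false ∷ [])) ≅ K̄2∪K2
CG₁-K₄-minus-edge = ≅-by-evaluation _ (adj K̄2∪K2) refl

CG₁-K₅-minus-P₃ : CG₁ (H₂¹-model (false ∷ true ∷ [])) ≅ K̄2∪P3
CG₁-K₅-minus-P₃ = ≅-by-evaluation _ (adj K̄2∪P3) refl

lemma1 : (G : Graph) → IsSimple G → SP-graph G → MinDegree G 2
    → (∀ v → ¬ IsFull G v)
    → SP-graph (CG₁ G) → InH21 (CG₁ G)
    → ¬ SP-graph (CG₁ (CG₁ G))
      × (CG₁ (CG₁ G) ≅ K̄4 ⊎ CG₁ (CG₁ G) ≅ K̄3∪K2 ⊎ CG₁ (CG₁ G) ≅ K̄2∪K2 ⊎ CG₁ (CG₁ G) ≅ K̄2∪P3)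
lemma1 G _ _ _ _ sp (x , y , z , x≢y , x≢z , y≢z , x~y , x~z , y~z , (r , r∈R) , R~yz , R-independent) =
    two-isolated⇒¬SP-graph (y≢z ∘ sym) x≢y x≢z
      (dominating⇒isolated-in-CG₁ y-dominating) (dominating⇒isolated-in-CG₁ z-dominating)
  , chain-end (classification r∈R)
  where
  B = CG₁ G
  open H₂¹-structure B (CG₁-simple G) sp x≢y x≢z y≢z x~y x~z y~z R~yz R-independent

  via : ∀ {M} T → M ≅ B → CG₁ M ≅ T → CG₁ B ≅ T
  via T M≅B CG₁M≅T = ≅-trans {K = T} (≅-sym (CG₁-cong M≅B)) CG₁M≅T

  chain-end : Classified → CG₁ B ≅ K̄4 ⊎ CG₁ B ≅ K̄3∪K2 ⊎ CG₁ B ≅ K̄2∪K2 ⊎ CG₁ B ≅ K̄2∪P3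
  chain-end (inj₁ M≅B)               = inj₁ (via K̄4 M≅B CG₁-K₄)
  chain-end (inj₂ (inj₁ M≅B))        = inj₂ (inj₁ (via K̄3∪K2 M≅B CG₁-K₅-minus-edge))
  chain-end (inj₂ (inj₂ (inj₁ M≅B))) = inj₂ (inj₂ (inj₁ (via K̄2∪K2 M≅B CG₁-K₄-minus-edge)))
  chain-end (inj₂ (inj₂ (inj₂ M≅B))) = inj₂ (inj₂ (inj₂ (via K̄2∪P3 M≅B CG₁-K₅-minus-P₃)))
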